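{- (Decidable Learning Meta-Theorem.) Let $(\mathcal{L},\mathcal{M},\models)$ be a symbolic language with semantic domain $D$. Suppose there is a well-formed $\textsc{Facet}$ program $P$ over it (with computable signature functions) such that for all $M\in\mathcal{M}$ the set $\mathsf{Asp}(M)$ is finite, and for all $e\in\mathcal{L}$ and $d\in D$ there is a state $\sigma_d\in\mathsf{Asp}(M)$ for which $(M,\mathit{root}(e),\mathit{C}(P),\sigma_d)\Downarrow_p$ holds if and only if $M\models e=d$. Then $(\mathcal{L},\mathcal{M},\models)$ has decidable learning: given a finite set of examples $(M_i,d_i)_i\subseteq\mathcal{M}\times D$ and a regular tree grammar $\mathcal{G}$ over syntax trees of $\mathcal{L}$, one can decide whether there exists $e\in L(\mathcal{G})$ with $M_i\models e=d_i$ for all $i$, and if so compute such an $e$.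
   Context: A symbolic language $(\mathcal{L},\mathcal{M},\models)$ consists of a set of expressions $\mathcal{L}$ (identified with their syntax trees over a finite ranked alphabet $\Delta$), a class $\mathcal{M}$ of finitely representable structures, and a semantic function $\models:\mathcal{M}\times\mathcal{L}\to D$; $M\models e=d$ means the value is $d$. A regular tree grammar $\mathcal{G}=(\mathit{NT},\Delta,S,P)$ has productions $A\to t$ with $t$ a term over $\Delta$ and nonterminals; $L(\mathcal{G})$ is the set of ground terms derivable from $S$. A $\textsc{Facet}$ program $P$ is given by: a set $\mathsf{Asp}$ of auxiliary states with, for each structure $M$, a subset $\mathsf{Asp}(M)$ used on $M$; sets $S$ of state functions and $B$ of Boolean functions (closed under complement) on structures; and a finite set $\mathit{C}(P)$ of clauses of the form "P($M$, $\sigma(z)$, $n$) = match $n.l$ with $\alpha_1(z)\to e_1\ \dots\ \alpha_m(z)\to e_m$", with $\sigma(z)$ a state pattern, $n$ a pointer into a syntax tree, $n.l$ its label, $\alpha_i(z)$ alphabet patterns, and expressions $e ::= \texttt{True}\mid\texttt{False}\mid f(z)\mid e_1\ \texttt{and}\ e_2\mid e_1\ \texttt{or}\ e_2\mid \mathrm{P}(M,\sigma(z),n.\mathit{dir})\mid \texttt{all}(\lambda x.e)\,g(z)\mid \texttt{any}(\lambda x.e)\,g(z)\mid \texttt{if}\ f(z)\ \texttt{then}\ e_1\ \texttt{else}\ e_2$, with $f\in B$, $g\in S$ (returning a finite set), $\mathit{dir}\in\{\mathit{up},\mathit{stay},c_1,\dots,c_k\}$. Well-formed: for every $M$ and $\sigma\in\mathsf{Asp}(M)$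 exactly one clause's state pattern matches $\sigma$, no free variables, and moves respect arities. Semantics: $(M,n,\mathit{C}(P),\sigma)\Downarrow_p$ holds iff for the unique clause matching $\sigma$ and the first case whose alphabet pattern matches $n.l$, the instantiated case expression $e$ satisfies $(M,n,\mathit{C}(P),e)\Downarrow_e$, where $\Downarrow_e$ is the least relation such that: True holds; $f(v)$ holds iff $f$ evaluates to true on $M$; and/or are conjunction/disjunction; the if-expression holds iff the branch selected by $f(v)$ holds; $\texttt{all}$ (resp. $\texttt{any}$) holds iff the body holds for every (resp. some) element of the finite set $g(v)$ computed on $M$; a call $\mathrm{P}(M,\sigma(v),n.\mathit{dir})$ holds iff $n.\mathit{dir}$ exists and $(M,n.\mathit{dir},\mathit{C}(P),\sigma')\Downarrow_p$ for the state $\sigma'$ denoted by $\sigma(v)$. $\mathit{root}(e)$ points to the root of $e$'s syntax tree. -}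

module Defs where

open import Data.Nat using (ℕ; zero; suc)
open import Data.Fin using (Fin)
open import Data.Vec using (Vec; []; _∷_)
open import Data.List using (List; []; _∷_; reverse)
open import Data.List.Membership.Propositional using (_∈_)
open import Data.List.Relation.Unary.All using (All)
open import Data.Maybe using (Maybe; just; nothing)
open import Data.Bool using (Bool; true; false)
open import Data.Product using (Σ; _×_; _,_; proj₁; proj₂)
open import Relation.Nullary using (Dec)
open import Relation.Binary.PropositionalEquality using (_≡_)

data Tree {k : ℕ} (ar : Fin k → ℕ) : Set where
  node : (a : Fin k) → Vec (Tree ar) (ar a) → Tree ar

-- Subtree reached by a root-first path of child indices (0-based)
module _ {k : ℕ} {ar : Fin k → ℕ} where
  subtreeAt  : Tree ar → List ℕ → Maybe (Tree ar)
  subtreeAtV : ∀ {n} → Vec (Tree ar) n → ℕ → List ℕ → Maybe (Tree ar)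
  subtreeAt t [] = just t
  subtreeAt (node a ts) (i ∷ p) = subtreeAtV ts i p
  subtreeAtV [] i p = nothing
  subtreeAtV (t ∷ ts) zero p = subtreeAt t p
  subtreeAtV (t ∷ ts) (suc i) p = subtreeAtV ts i p

-- A pointer into a tree: the path from the root, stored deepest step first.
-- The root pointer root(e) is [].
Pointer : Set
Pointer = List ℕ

nodeAt : ∀ {k} {ar : Fin k → ℕ} → Tree ar → Pointer → Maybe (Tree ar)
nodeAt t n = subtreeAt t (reverse n)

-- Directions: up, stay, child c_(i+1)
data Dir : Set where
  up   : Dir
  stay : Dir
  child : ℕ → Dir

-- n.dir as a candidate pointer (whether it exists is checked with nodeAt)
move : Pointer → Dir → Maybe Pointer
move [] up = nothing
move (i ∷ n) up = just n
move n stay = just n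
move n (child i) = just (i ∷ n)

record SymbolicLanguage : Set₁ where
  field
    k      : ℕ
    ar     : Fin k → ℕ
    Struct : Set
    D      : Set
    sem    : Struct → Tree ar → D      -- sem M e = d  means  M ⊨ e = d

-- FACET expressions (variables bound by patterns / all / any are
-- represented by Agda binders; f ∈ B are Struct → Bool, g ∈ S are
-- Struct → finite set (List) of values)

data Expr (Struct State Val : Set) : Set where
  True  : Expr Struct State Val
  False : Expr Struct State Val
  bool  : (Struct → Bool) → Expr Struct State Val
  _and_ : Expr Struct State Val → Expr Struct State Val → Expr Struct State Val
  _or_  : Expr Struct State Val → Expr Struct State Val → Expr Struct State Val
  call  : State → Dir → Expr Struct State Val
  all   : (Struct → List Val) → (Val → Expr Struct State Val) → Expr Struct State Val
  any   : (Struct → List Val) → (Val → Expr Struct State Val) → Expr Struct State Val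
  ite   : (Struct → Bool) → Expr Struct State Val → Expr Struct State Val → Expr Struct State Val

-- A FACET program: states, finite auxiliary state sets Asp(M) (given as
-- finite lists), and the clause table: for a state σ the unique matching
-- clause, and for a label a the case expression selected by the first
-- matching alphabet pattern (False if none matches).
record Facet (L : SymbolicLanguage) : Set₁ where
  open SymbolicLanguage L
  field
    State  : Set
    Val    : Set
    Asp    : Struct → List State
    clause : State → Fin k → Expr Struct State Val

module Semantics (L : SymbolicLanguage) (P : Facet L) where
  open SymbolicLanguage L
  open Facet P

  Exp : Set
  Exp = Expr Struct State Val

  data EvalP (M : Struct) (t : Tree ar) : Pointer → State → Set
  data EvalE (M : Struct) (t : Tree ar) : Pointer → Exp → Set

  data EvalP M t where
    evalP : ∀ {n σ a cs} → nodeAt t n ≡ just (node a cs) →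
            EvalE M t n (clause σ a) → EvalP M t n σ

  data EvalE M t where
    e-true : ∀ {n} → EvalE M t n True
    e-bool : ∀ {n f} → f M ≡ true → EvalE M t n (bool f)
    e-and  : ∀ {n e₁ e₂} → EvalE M t n e₁ → EvalE M t n e₂ → EvalE M t n (e₁ and e₂)
    e-orˡ  : ∀ {n e₁ e₂} → EvalE M t n e₁ → EvalE M t n (e₁ or e₂)
    e-orʳ  : ∀ {n e₁ e₂} → EvalE M t n e₂ → EvalE M t n (e₁ or e₂)
    e-all  : ∀ {n g b} → (∀ x → x ∈ g M → EvalE M t n (b x)) → EvalE M t n (all g b)
    e-any  : ∀ {n g b x} → x ∈ g M → EvalE M t n (b x) → EvalE M t n (any g b)
    e-ifᵗ  : ∀ {n f e₁ e₂} → f M ≡ true  → EvalE M t n e₁ → EvalE M t n (ite f e₁ e₂)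
    e-ifᶠ  : ∀ {n f e₁ e₂} → f M ≡ false → EvalE M t n e₂ → EvalE M t n (ite f e₁ e₂)
    e-call : ∀ {n n' σ dir} → move n dir ≡ just n' → EvalP M t n' σ →
             EvalE M t n (call σ dir)

  data CallsIn (M : Struct) : Exp → Set where
    c-true  : CallsIn M True
    c-false : CallsIn M False
    c-bool  : ∀ {f} → CallsIn M (bool f)
    c-and   : ∀ {e₁ e₂} → CallsIn M e₁ → CallsIn M e₂ → CallsIn M (e₁ and e₂)
    c-or    : ∀ {e₁ e₂} → CallsIn M e₁ → CallsIn M e₂ → CallsIn M (e₁ or e₂)
    c-call  : ∀ {σ dir} → σ ∈ Asp M → CallsIn M (call σ dir)
    c-all   : ∀ {g b} → (∀ x → x ∈ g M → CallsIn M (b x)) → CallsIn M (all g b)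
    c-any   : ∀ {g b} → (∀ x → x ∈ g M → CallsIn M (b x)) → CallsIn M (any g b)
    c-ifᵗ   : ∀ {f e₁ e₂} → f M ≡ true  → CallsIn M e₁ → CallsIn M (ite f e₁ e₂)
    c-ifᶠ   : ∀ {f e₁ e₂} → f M ≡ false → CallsIn M e₂ → CallsIn M (ite f e₁ e₂)

  WellFormed : Set
  WellFormed = ∀ M σ → σ ∈ Asp M → ∀ a → CallsIn M (clause σ a)

  Characterizes : Set
  Characterizes = (M : Struct) (d : D) →
    Σ State λ σ → σ ∈ Asp M ×
      ((e : Tree ar) → (EvalP M e [] σ → sem M e ≡ d) × (sem M e ≡ d → EvalP M e [] σ))

data RHS {k : ℕ} (ar : Fin k → ℕ) (m : ℕ) : Set where
  nt  : Fin m → RHS ar m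
  sym : (a : Fin k) → Vec (RHS ar m) (ar a) → RHS ar m

record RTG {k : ℕ} (ar : Fin k → ℕ) : Set where
  field
    m     : ℕ
    start : Fin m
    prods : List (Fin m × RHS ar m)

module _ {k : ℕ} {ar : Fin k → ℕ} (G : RTG ar) where
  open RTG G
  data Derives : Fin m → Tree ar → Set
  data Matches : RHS ar m → Tree ar → Set
  data MatchesV : ∀ {n} → Vec (RHS ar m) n → Vec (Tree ar) n → Set

  data Derives where
    derive : ∀ {A r t} → (A , r) ∈ prods → Matches r t → Derives A t

  data Matches where
    m-nt  : ∀ {B t} → Derives B t → Matches (nt B) t
    m-sym : ∀ {a rs ts} → MatchesV rs ts → Matches (sym a rs) (node a ts)

  data MatchesV where
    []  : MatchesV [] []
    _∷_ : ∀ {n r t} {rs : Vec (RHS ar m) n} {ts} →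
          Matches r t → MatchesV rs ts → MatchesV (r ∷ rs) (t ∷ ts)

  InLang : Tree ar → Set
  InLang = Derives start

HasDecidableLearning : SymbolicLanguage → Set
HasDecidableLearning L =
  (exs : List (Struct × D)) (G : RTG ar) →
  Dec (Σ (Tree ar) λ e → InLang G e × All (λ ex → sem (proj₁ ex) e ≡ proj₂ ex) exs)
  where open SymbolicLanguage L

-- For a fixed structure M the Facet program is a two-way tree automaton with the finite
-- state set Asp(M), and whether a state holds at a node depends both on the subtree below
-- and on what holds at the parent. It is made bottom-up by summarising a subtree s as the
-- function sending the set U of states holding at the parent of s to the set of states
-- holding at the root of s: the least solution of the root's clauses, with up-calls read off
-- U and child-calls answered by the children's summaries. Summaries range over a finite set,
-- so each example (M_i, d_i) becomes a finite algebra with a decidable acceptance condition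
-- (via the characterising state σ_{d_i}), and so does their product. Saturating the grammar's
-- nonterminals with the algebra values of the trees they derive then decides whether some
-- e ∈ L(G) satisfies every example, and produces one.

module Submission where

open import Defs

open import Data.Bool using (Bool; true; false; T; _∨_; if_then_else_)
import Data.Bool as Bool
open import Data.Bool.Properties using (T?; T-∨)
open import Data.Empty using (⊥; ⊥-elim)
open import Data.Fin as Fin using (Fin)
open import Data.List
  using (List; []; _∷_; [_]; _∷ʳ_; length; reverse; map; filter; allFin; cartesianProductWith)
import Data.List as List
open import Data.List.Membership.Propositional using (_∈_; lose; find)
import Data.List.Membership.DecPropositional as DecMembership
open import Data.List.Membership.Propositional.Properties
  using ( ∈-cartesianProductWith⁺; ∈-cartesianProductWith⁻; ∈-allFin; ∈-lookup
        ; ∈-map⁺; ∈-map⁻; ∈-filter⁺; ∈-filter⁻)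
open import Data.List.Properties using (unfold-reverse)
open import Data.List.Relation.Unary.All using (All; []; _∷_)
open import Data.List.Relation.Unary.Any using (Any; here; there; any?; index)
open import Data.List.Relation.Unary.Any.Properties using (lookup-index)
open import Data.Maybe using (Maybe; just; nothing; maybe′; _>>=_)
import Data.Maybe as Maybe
import Data.Maybe.Properties as Maybe
open import Data.Nat using (ℕ; zero; suc; _+_; _≤_; _<_; z≤n; s≤s)
open import Data.Nat.Properties
  using (≤-refl; ≤-trans; m≤n⇒m≤1+n; +-monoʳ-≤; +-suc; m≤m+n; <-irrefl; ≤-<-trans)
open import Data.Product using (Σ; ∃; _×_; _,_; proj₁; proj₂; uncurry)
open import Data.Product.Function.NonDependent.Propositional using (_×-⇔_)
import Data.Product.Properties as Product
open import Data.Sum using (_⊎_; inj₁; inj₂)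
open import Data.Unit using (⊤; tt)
open import Data.Vec using (Vec; []; _∷_; lookup; replicate; tabulate)
import Data.Vec as Vec
import Data.Vec.Properties as Vec
open import Data.Vec.Properties using (lookup-replicate; lookup∘tabulate)
open import Data.Vec.Relation.Binary.Pointwise.Inductive using (Pointwise; []; _∷_)
open import Function using (_∘_; _∘′_; _⇔_; mk⇔; Equivalence)
open import Function.Construct.Composition using (_⇔-∘_)
open import Relation.Binary using (DecidableEquality)
open import Relation.Binary.PropositionalEquality using (_≡_; refl; cong; cong₂)
import Relation.Binary.PropositionalEquality as ≡
open import Relation.Nullary using (¬_; Dec; yes; no; ¬?; ⌊_⌋)
open import Relation.Nullary.Decidable
  using (_×-dec_; _⊎-dec_; map′; decidable-stable; toWitness; fromWitness)
open import Relation.Unary using (Decidable)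

sequence : ∀ {A : Set} {l} → Vec (List A) l → List (Vec A l)
sequence []         = [ [] ]
sequence (xs ∷ xss) = cartesianProductWith _∷_ xs (sequence xss)

∈-sequence⁺ : ∀ {A : Set} {l} {v : Vec A l} {xss} → Pointwise _∈_ v xss → v ∈ sequence xss
∈-sequence⁺ []         = here refl
∈-sequence⁺ (x∈ ∷ v∈) = ∈-cartesianProductWith⁺ _∷_ x∈ (∈-sequence⁺ v∈)

∈-sequence⁻ : ∀ {A : Set} {l} {v : Vec A l} xss → v ∈ sequence xss → Pointwise _∈_ v xss
∈-sequence⁻ []         (here refl) = []
∈-sequence⁻ (xs ∷ xss) v∈ with ∈-cartesianProductWith⁻ _∷_ xs (sequence xss) v∈
... | _ , _ , x∈ , w∈ , refl = x∈ ∷ ∈-sequence⁻ xss w∈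

module _ {A : Set} where

  ∀∈? : ∀ (xs : List A) {P : ∀ x → x ∈ xs → Set} → (∀ x x∈ → Dec (P x x∈)) → Dec (∀ x x∈ → P x x∈)
  ∀∈? []       P? = yes λ _ ()
  ∀∈? (y ∷ xs) P? = map′ (λ { (p , ps) _ (here refl) → p ; (p , ps) x (there x∈) → ps x x∈ })
                         (λ ps → ps y (here refl) , λ x → ps x ∘ there)
                         (P? y (here refl) ×-dec ∀∈? xs (λ x → P? x ∘ there))

  ∃∈? : ∀ (xs : List A) {P : ∀ x → x ∈ xs → Set} → (∀ x x∈ → Dec (P x x∈)) →
        Dec (∃ λ x → Σ (x ∈ xs) (P x))
  ∃∈? []       P? = no λ ()
  ∃∈? (y ∷ xs) P? = map′ (λ { (inj₁ p) → y , here refl , p ; (inj₂ (x , x∈ , p)) → x , there x∈ , p })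
                         (λ { (_ , here refl , p) → inj₁ p ; (x , there x∈ , p) → inj₂ (x , x∈ , p) })
                         (P? y (here refl) ⊎-dec ∃∈? xs (λ x → P? x ∘ there))

record Finite (A : Set) : Set where
  field
    _≟_      : DecidableEquality A
    elements : List A
    complete : ∀ x → x ∈ elements

⊤-finite : Finite ⊤
⊤-finite = record { _≟_ = λ _ _ → yes refl ; elements = [ tt ] ; complete = λ _ → here refl }

×-finite : ∀ {A B} → Finite A → Finite B → Finite (A × B)
×-finite FA FB = record
  { _≟_      = Product.≡-dec A._≟_ B._≟_
  ; elements = cartesianProductWith _,_ A.elements B.elements
  ; complete = λ (x , y) → ∈-cartesianProductWith⁺ _,_ (A.complete x) (B.complete y)
  }
  where
    module A = Finite FA
    module B = Finite FB

Vec-finite : ∀ {A} n → Finite A → Finite (Vec A n)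
Vec-finite {A} n FA = record
  { _≟_      = Vec.≡-dec _≟_
  ; elements = sequence (replicate n elements)
  ; complete = ∈-sequence⁺ ∘ all∈
  }
  where
    open Finite FA
    all∈ : ∀ {l} (v : Vec A l) → Pointwise _∈_ v (replicate l elements)
    all∈ []      = []
    all∈ (x ∷ v) = complete x ∷ all∈ v

Fin-finite : ∀ n → Finite (Fin n)
Fin-finite n = record { _≟_ = Fin._≟_ ; elements = allFin n ; complete = ∈-allFin }

Bool-finite : Finite Bool
Bool-finite = record
  { _≟_ = Bool._≟_ ; elements = false ∷ true ∷ []
  ; complete = λ { false → here refl ; true → there (here refl) } }

-- Functions Vec Bool n → A as complete binary trees, so that they have decidable equality
-- and can be enumerated.
Table : ℕ → Set → Set
Table zero    A = A
Table (suc n) A = Table n A × Table n A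

apply : ∀ {n A} → Table n A → Vec Bool n → A
apply x       []          = x
apply (l , r) (false ∷ v) = apply l v
apply (l , r) (true ∷ v)  = apply r v

table : ∀ {n A} → (Vec Bool n → A) → Table n A
table {zero}  f = f []
table {suc n} f = table (f ∘′ (false ∷_)) , table (f ∘′ (true ∷_))

apply-table : ∀ {n A} (f : Vec Bool n → A) v → apply (table f) v ≡ f v
apply-table f []          = refl
apply-table f (false ∷ v) = apply-table (λ w → f (false ∷ w)) v
apply-table f (true ∷ v)  = apply-table (λ w → f (true ∷ w)) v

Table-finite : ∀ {A} n → Finite A → Finite (Table n A)
Table-finite zero    FA = FA
Table-finite (suc n) FA = ×-finite (Table-finite n FA) (Table-finite n FA)

-- Iterates X ↦ X ∪ f X from ∅ until nothing new appears; each productive round adds an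
-- element, so length elements + 1 rounds suffice.
module InflationaryFixpoint {U : Set} (U-finite : Finite U) where

  open Finite U-finite using (elements; complete)

  Subset : Set
  Subset = U → Bool

  ∅ : Subset
  ∅ _ = false

  _∪_ : Subset → Subset → Subset
  (X ∪ Y) x = X x ∨ Y x

  size : List U → Subset → ℕ
  size []       X = 0
  size (x ∷ xs) X = (if X x then 1 else 0) + size xs X

  size≤length : ∀ xs X → size xs X ≤ length xs
  size≤length []       X = z≤n
  size≤length (x ∷ xs) X with X x
  ... | true  = s≤s (size≤length xs X)
  ... | false = m≤n⇒m≤1+n (size≤length xs X)

  size-∪ : ∀ xs X Y → size xs X ≤ size xs (X ∪ Y)
  size-∪ []       X Y = z≤n
  size-∪ (x ∷ xs) X Y with X x | Y x
  ... | true  | _     = s≤s (size-∪ xs X Y)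
  ... | false | true  = m≤n⇒m≤1+n (size-∪ xs X Y)
  ... | false | false = size-∪ xs X Y

  size-∪-new : ∀ {x} xs X Y → x ∈ xs → ¬ T (X x) → T (Y x) → size xs X < size xs (X ∪ Y)
  size-∪-new {x} (x ∷ xs) X Y (here refl) ¬Xx Yx with X x | Y x
  ... | false | true = s≤s (size-∪ xs X Y)
  ... | true  | _    = ⊥-elim (¬Xx _)
  size-∪-new (y ∷ xs) X Y (there x∈) ¬Xx Yx with X y | Y y
  ... | true  | _     = s≤s (size-∪-new xs X Y x∈ ¬Xx Yx)
  ... | false | true  = ≤-trans (size-∪-new xs X Y x∈ ¬Xx Yx) (m≤n⇒m≤1+n ≤-refl)
  ... | false | false = size-∪-new xs X Y x∈ ¬Xx Yx

  module _ (f : Subset → Subset) where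

    Fresh : Subset → U → Set
    Fresh X x = T (f X x) × ¬ T (X x)

    fresh? : ∀ X → Dec (Any (Fresh X) elements)
    fresh? X = any? (λ x → T? (f X x) ×-dec ¬? (T? (X x))) elements

    iterate : ℕ → Subset → Subset
    iterate zero    X = X
    iterate (suc s) X with fresh? X
    ... | yes _ = iterate s (X ∪ f X)
    ... | no  _ = X

    lfp : Subset
    lfp = iterate (suc (length elements)) ∅

    iterate-closed : ∀ s X → length elements < s + size elements X →
                     ∀ x → T (f (iterate s X) x) → T (iterate s X x)
    iterate-closed zero X bound x _ =
      ⊥-elim (<-irrefl refl (≤-<-trans (size≤length elements X) bound))
    iterate-closed (suc s) X bound x with fresh? X
    ... | yes new = iterate-closed s (X ∪ f X) bound′ x
      where
        grows : size elements X < size elements (X ∪ f X)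
        grows with _ , x∈ , fXx , ¬Xx ← find new = size-∪-new elements X (f X) x∈ ¬Xx fXx
        bound′ : length elements < s + size elements (X ∪ f X)
        bound′ = ≤-trans bound
          (≡.subst (_≤ s + size elements (X ∪ f X)) (+-suc s _) (+-monoʳ-≤ s grows))
    ... | no ¬new = λ fXx → decidable-stable (T? (X x)) λ ¬Xx → ¬new (lose (complete x) (fXx , ¬Xx))

    lfp-closed : ∀ x → T (f lfp x) → T (lfp x)
    lfp-closed = iterate-closed (suc (length elements)) ∅ (s≤s (m≤m+n _ _))

    module _ (P : Subset → Set) (P-step : ∀ X → P X → P (X ∪ f X)) where

      iterate-induction : ∀ s X → P X → P (iterate s X)
      iterate-induction zero    X PX = PX
      iterate-induction (suc s) X PX with fresh? X
      ... | yes _ = iterate-induction s (X ∪ f X) (P-step X PX)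
      ... | no  _ = PX

      lfp-induction : P ∅ → P lfp
      lfp-induction = iterate-induction (suc (length elements)) ∅

record FiniteAlgebra {k : ℕ} (ar : Fin k → ℕ) : Set₁ where
  field
    Carrier : Set
    finite  : Finite Carrier
    op      : (a : Fin k) → Vec Carrier (ar a) → Carrier

  eval  : Tree ar → Carrier
  evals : ∀ {l} → Vec (Tree ar) l → Vec Carrier l
  eval (node a ts) = op a (evals ts)
  evals []       = []
  evals (t ∷ ts) = eval t ∷ evals ts

module _ {k : ℕ} {ar : Fin k → ℕ} where

  ⊤-algebra : FiniteAlgebra ar
  ⊤-algebra = record { Carrier = ⊤ ; finite = ⊤-finite ; op = λ _ _ → tt }

  _×-algebra_ : FiniteAlgebra ar → FiniteAlgebra ar → FiniteAlgebra ar
  𝒜 ×-algebra ℬ = record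
    { Carrier = A.Carrier × B.Carrier
    ; finite  = ×-finite A.finite B.finite
    ; op      = λ a v → A.op a (Vec.map proj₁ v) , B.op a (Vec.map proj₂ v)
    }
    where
      module A = FiniteAlgebra 𝒜
      module B = FiniteAlgebra ℬ

  module _ (𝒜 ℬ : FiniteAlgebra ar) where
    private
      module A = FiniteAlgebra 𝒜
      module B = FiniteAlgebra ℬ
      module AB = FiniteAlgebra (𝒜 ×-algebra ℬ)

    eval-× : ∀ t → AB.eval t ≡ (A.eval t , B.eval t)
    evals-×₁ : ∀ {l} (ts : Vec (Tree ar) l) → Vec.map proj₁ (AB.evals ts) ≡ A.evals ts
    evals-×₂ : ∀ {l} (ts : Vec (Tree ar) l) → Vec.map proj₂ (AB.evals ts) ≡ B.evals ts
    eval-× (node a ts) = cong₂ _,_ (cong (A.op a) (evals-×₁ ts)) (cong (B.op a) (evals-×₂ ts))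
    evals-×₁ []       = refl
    evals-×₁ (t ∷ ts) = cong₂ _∷_ (cong proj₁ (eval-× t)) (evals-×₁ ts)
    evals-×₂ []       = refl
    evals-×₂ (t ∷ ts) = cong₂ _∷_ (cong proj₂ (eval-× t)) (evals-×₂ ts)

  record Recognizable (P : Tree ar → Set) : Set₁ where
    field
      algebra    : FiniteAlgebra ar
      Accepting  : FiniteAlgebra.Carrier algebra → Set
      accepting? : Decidable Accepting
      recognizes : ∀ t → Accepting (FiniteAlgebra.eval algebra t) ⇔ P t

  Recognizable-resp : ∀ {P Q} → (∀ t → P t ⇔ Q t) → Recognizable P → Recognizable Q
  Recognizable-resp P⇔Q R = record
    { algebra = algebra ; Accepting = Accepting ; accepting? = accepting?
    ; recognizes = λ t → P⇔Q t ⇔-∘ recognizes t }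
    where open Recognizable R

  Recognizable-⊤ : Recognizable (λ _ → ⊤)
  Recognizable-⊤ = record
    { algebra = ⊤-algebra ; Accepting = λ _ → ⊤ ; accepting? = λ _ → yes tt
    ; recognizes = λ _ → mk⇔ _ _ }

  Recognizable-× : ∀ {P Q} → Recognizable P → Recognizable Q → Recognizable (λ t → P t × Q t)
  Recognizable-× RP RQ = record
    { algebra    = P.algebra ×-algebra Q.algebra
    ; Accepting  = λ xy → P.Accepting (proj₁ xy) × Q.Accepting (proj₂ xy)
    ; accepting? = λ xy → P.accepting? (proj₁ xy) ×-dec Q.accepting? (proj₂ xy)
    ; recognizes = recognizes
    }
    where
      module P = Recognizable RP
      module Q = Recognizable RQ
      open FiniteAlgebra (P.algebra ×-algebra Q.algebra) using (eval)
      recognizes : ∀ t → (P.Accepting (proj₁ (eval t)) × Q.Accepting (proj₂ (eval t))) ⇔ (_ × _)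
      recognizes t rewrite eval-× P.algebra Q.algebra t = P.recognizes t ×-⇔ Q.recognizes t

  Recognizable-All : ∀ {I : Set} {P : I → Tree ar → Set} →
                     (∀ i → Recognizable (P i)) → ∀ is → Recognizable (λ t → All (λ i → P i t) is)
  Recognizable-All R []       = Recognizable-resp (λ _ → mk⇔ (λ _ → []) _) Recognizable-⊤
  Recognizable-All R (i ∷ is) =
    Recognizable-resp (λ _ → mk⇔ (uncurry _∷_) (λ { (p ∷ ps) → p , ps }))
                      (Recognizable-× (R i) (Recognizable-All R is))

  module Derivable (𝒜 : FiniteAlgebra ar) (G : RTG ar) where
    open FiniteAlgebra 𝒜
    open Finite finite using (elements; complete; _≟_)
    open RTG G
    open DecMembership _≟_ using (_∈?_)
    open InflationaryFixpoint (×-finite (Fin-finite m) finite)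

    values  : RHS ar m → Subset → List Carrier
    valuess : ∀ {l} → Vec (RHS ar m) l → Subset → Vec (List Carrier) l
    values (nt B)     R = filter (λ τ → T? (R (B , τ))) elements
    values (sym a rs) R = map (op a) (sequence (valuess rs R))
    valuess []       R = []
    valuess (r ∷ rs) R = values r R ∷ valuess rs R

    produce : Subset → Subset
    produce R (A , τ) = ⌊ any? (λ (B , r) → (B Fin.≟ A) ×-dec (τ ∈? values r R)) prods ⌋

    derivable : Subset
    derivable = lfp produce

    Sound : Subset → Set
    Sound R = ∀ {A τ} → T (R (A , τ)) → Σ (Tree ar) λ t → Derives G A t × eval t ≡ τ

    values-sound  : ∀ {R} → Sound R → ∀ r {τ} → τ ∈ values r R →
                    Σ (Tree ar) λ t → Matches G r t × eval t ≡ τ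
    valuess-sound : ∀ {R} → Sound R → ∀ {l} (rs : Vec (RHS ar m) l) {vs} →
                    Pointwise _∈_ vs (valuess rs R) →
                    Σ (Vec (Tree ar) l) λ ts → MatchesV G rs ts × evals ts ≡ vs
    values-sound {R} sound (nt B) τ∈ =
      let t , d , eq = sound (proj₂ (∈-filter⁻ (λ τ → T? (R (B , τ))) {xs = elements} τ∈))
      in t , m-nt d , eq
    values-sound {R} sound (sym a rs) τ∈
      with vs , vs∈ , refl ← ∈-map⁻ (op a) τ∈
      with ts , ms , refl ← valuess-sound sound rs (∈-sequence⁻ (valuess rs R) vs∈) =
      node a ts , m-sym ms , refl
    valuess-sound sound []       []          = [] , [] , refl
    valuess-sound sound (r ∷ rs) (τ∈ ∷ vs∈)
      with t , mt , refl ← values-sound sound r τ∈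
      with ts , ms , refl ← valuess-sound sound rs vs∈ = t ∷ ts , mt ∷ ms , refl

    produce-sound : ∀ R → Sound R → Sound (R ∪ produce R)
    produce-sound R sound p with Equivalence.to T-∨ p
    ... | inj₁ q = sound q
    ... | inj₂ q with _ , B,r∈ , refl , τ∈ ← find (toWitness q)
                 with t , mt , eq ← values-sound sound _ τ∈ = t , derive B,r∈ mt , eq

    derivable-sound : Sound derivable
    derivable-sound = lfp-induction produce Sound produce-sound λ ()

    derivable-complete : ∀ {A t} → Derives G A t → T (derivable (A , eval t))
    values-complete    : ∀ {r t} → Matches G r t → eval t ∈ values r derivable
    valuess-complete   : ∀ {l} {rs : Vec (RHS ar m) l} {ts} → MatchesV G rs ts →
                         Pointwise _∈_ (evals ts) (valuess rs derivable)
    derivable-complete {A} {t} (derive r∈ mt) =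
      lfp-closed produce (A , eval t) (fromWitness (lose r∈ (refl , values-complete mt)))
    values-complete (m-nt d) =
      ∈-filter⁺ (λ τ → T? (derivable (_ , τ))) (complete _) (derivable-complete d)
    values-complete (m-sym {a = a} ms) = ∈-map⁺ (op a) (∈-sequence⁺ (valuess-complete ms))
    valuess-complete []        = []
    valuess-complete (mt ∷ ms) = values-complete mt ∷ valuess-complete ms

  ∃-InLang? : ∀ {P} → Recognizable P → (G : RTG ar) → Dec (Σ (Tree ar) λ t → InLang G t × P t)
  ∃-InLang? {P} R G =
    map′ tree-of value-of (any? (λ τ → T? (derivable (start , τ)) ×-dec accepting? τ) elements)
    where
      open Recognizable R
      open FiniteAlgebra algebra
      open Finite finite using (elements; complete)
      open RTG G using (start)
      open Derivable algebra G using (derivable; derivable-sound; derivable-complete)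

      tree-of : Any (λ τ → T (derivable (start , τ)) × Accepting τ) elements →
                Σ (Tree ar) λ t → InLang G t × P t
      tree-of ∃τ with _ , _ , d , acc ← find ∃τ with t , dt , refl ← derivable-sound d =
        t , dt , Equivalence.to (recognizes t) acc

      value-of : (Σ (Tree ar) λ t → InLang G t × P t) →
                 Any (λ τ → T (derivable (start , τ)) × Accepting τ) elements
      value-of (t , dt , p) =
        lose (complete (eval t)) (derivable-complete dt , Equivalence.from (recognizes t) p)

_‼_ : ∀ {A : Set} {l} → Vec A l → ℕ → Maybe A
[]       ‼ j     = nothing
(x ∷ xs) ‼ zero  = just x
(x ∷ xs) ‼ suc j = xs ‼ j

module _ {k : ℕ} {ar : Fin k → ℕ} where

  childAt : Tree ar → ℕ → Maybe (Tree ar)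
  childAt (node a ts) j = ts ‼ j

  subtreeAtV-[] : ∀ {l} (ts : Vec (Tree ar) l) j → subtreeAtV ts j [] ≡ ts ‼ j
  subtreeAtV-[] []       j       = refl
  subtreeAtV-[] (t ∷ ts) zero    = refl
  subtreeAtV-[] (t ∷ ts) (suc j) = subtreeAtV-[] ts j

  subtreeAt-∷ʳ  : ∀ t p j → subtreeAt t (p ∷ʳ j) ≡ (subtreeAt t p >>= λ s → childAt s j)
  subtreeAtV-∷ʳ : ∀ {l} (ts : Vec (Tree ar) l) i p j →
                  subtreeAtV ts i (p ∷ʳ j) ≡ (subtreeAtV ts i p >>= λ s → childAt s j)
  subtreeAt-∷ʳ (node a ts) []      j = subtreeAtV-[] ts j
  subtreeAt-∷ʳ (node a ts) (i ∷ p) j = subtreeAtV-∷ʳ ts i p j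
  subtreeAtV-∷ʳ []       i       p j = refl
  subtreeAtV-∷ʳ (t ∷ ts) zero    p j = subtreeAt-∷ʳ t p j
  subtreeAtV-∷ʳ (t ∷ ts) (suc i) p j = subtreeAtV-∷ʳ ts i p j

  nodeAt-child : ∀ t j m → nodeAt t (j ∷ m) ≡ (nodeAt t m >>= λ s → childAt s j)
  nodeAt-child t j m = ≡.trans (cong (subtreeAt t) (unfold-reverse j m)) (subtreeAt-∷ʳ t (reverse m) j)

  evals-‼ : ∀ (𝒜 : FiniteAlgebra ar) {l} (ts : Vec (Tree ar) l) j →
            FiniteAlgebra.evals 𝒜 ts ‼ j ≡ Maybe.map (FiniteAlgebra.eval 𝒜) (ts ‼ j)
  evals-‼ 𝒜 []       j       = refl
  evals-‼ 𝒜 (t ∷ ts) zero    = refl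
  evals-‼ 𝒜 (t ∷ ts) (suc j) = evals-‼ 𝒜 ts j

move-stay : ∀ m → move m stay ≡ just m
move-stay []      = refl
move-stay (_ ∷ _) = refl

move-child : ∀ m j → move m (child j) ≡ just (j ∷ m)
move-child []      j = refl
move-child (_ ∷ _) j = refl

module FacetAutomaton (L : SymbolicLanguage) (P : Facet L) (wf : Semantics.WellFormed L P)
                      (M : SymbolicLanguage.Struct L) where
  open SymbolicLanguage L
  open Facet P
  open Semantics L P

  n : ℕ
  n = length (Asp M)

  state : Fin n → State
  state = List.lookup (Asp M)

  state-index : ∀ {σ} (σ∈ : σ ∈ Asp M) → state (index σ∈) ≡ σ
  state-index σ∈ = ≡.sym (lookup-index σ∈)

  StateSet : Set
  StateSet = Vec Bool n

  none : StateSet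
  none = replicate n false

  none-empty : ∀ q → ¬ T (lookup none q)
  none-empty q rewrite lookup-replicate q false = λ ()

  Oracle : Set
  Oracle = Dir → Fin n → Bool

  -- A case expression with the truth of each called state supplied by an oracle; the
  -- CallsIn derivation given by well-formedness locates every called state in Asp M.
  Holds : ∀ {e} → CallsIn M e → Oracle → Set
  Holds c-true                  V = ⊤
  Holds c-false                 V = ⊥
  Holds (c-bool {f})            V = f M ≡ true
  Holds (c-and c₁ c₂)           V = Holds c₁ V × Holds c₂ V
  Holds (c-or c₁ c₂)            V = Holds c₁ V ⊎ Holds c₂ V
  Holds (c-call {dir = dir} σ∈) V = T (V dir (index σ∈))
  Holds (c-all {g} h)           V = ∀ x (x∈ : x ∈ g M) → Holds (h x x∈) V
  Holds (c-any {g} h)           V = ∃ λ x → Σ (x ∈ g M) λ x∈ → Holds (h x x∈) V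
  Holds (c-ifᵗ _ c)             V = Holds c V
  Holds (c-ifᶠ _ c)             V = Holds c V

  holds? : ∀ {e} (c : CallsIn M e) V → Dec (Holds c V)
  holds? c-true                  V = yes tt
  holds? c-false                 V = no λ ()
  holds? (c-bool {f})            V = f M Bool.≟ true
  holds? (c-and c₁ c₂)           V = holds? c₁ V ×-dec holds? c₂ V
  holds? (c-or c₁ c₂)            V = holds? c₁ V ⊎-dec holds? c₂ V
  holds? (c-call {dir = dir} σ∈) V = T? (V dir (index σ∈))
  holds? (c-all {g} h)           V = ∀∈? (g M) λ x x∈ → holds? (h x x∈) V
  holds? (c-any {g} h)           V = ∃∈? (g M) λ x x∈ → holds? (h x x∈) V
  holds? (c-ifᵗ _ c)             V = holds? c V
  holds? (c-ifᶠ _ c)             V = holds? c V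

  -- A subtree's summary: from the states holding at its parent to those holding at its root.
  Summary : Set
  Summary = Table n StateSet

  localOracle : ∀ {l} → StateSet → (Fin n → Bool) → Vec Summary l → Oracle
  localOracle U X hs up          = lookup U
  localOracle U X hs stay        = X
  localOracle U X hs (child j) q = maybe′ (λ h → lookup (apply h (tabulate X)) q) false (hs ‼ j)

  open InflationaryFixpoint (Fin-finite n)

  clauseAt : (a : Fin k) (q : Fin n) → CallsIn M (clause (state q) a)
  clauseAt a q = wf M (state q) (∈-lookup q) a

  step : (a : Fin k) → Vec Summary (ar a) → StateSet → Subset → Subset
  step a hs U X q = ⌊ holds? (clauseAt a q) (localOracle U X hs) ⌋

  summarize : (a : Fin k) → Vec Summary (ar a) → Summary
  summarize a hs = table λ U → tabulate (lfp (step a hs U))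

  algebra : FiniteAlgebra ar
  algebra = record
    { Carrier = Summary ; finite = Table-finite n (Vec-finite n Bool-finite) ; op = summarize }

  open FiniteAlgebra algebra using (eval; evals)

  lookup-eval : ∀ a cs U q → lookup (apply (eval (node a cs)) U) q ≡ lfp (step a (evals cs) U) q
  lookup-eval a cs U q = ≡.trans (cong (λ S → lookup S q) (apply-table _ U)) (lookup∘tabulate _ q)

  module _ (t : Tree ar) where

    CallHolds : Pointer → Dir → State → Set
    CallHolds m dir σ = Σ Pointer λ m′ → move m dir ≡ just m′ × EvalP M t m′ σ

    Realizes : Pointer → Oracle → Set
    Realizes m V = ∀ dir q → T (V dir q) → CallHolds m dir (state q)

    holds-sound : ∀ {e m V} (c : CallsIn M e) → Holds c V → Realizes m V → EvalE M t m e
    holds-sound c-true          _         _ = e-true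
    holds-sound c-bool          fM        _ = e-bool fM
    holds-sound (c-and c₁ c₂)   (h₁ , h₂) r = e-and (holds-sound c₁ h₁ r) (holds-sound c₂ h₂ r)
    holds-sound (c-or c₁ c₂)    (inj₁ h)  r = e-orˡ (holds-sound c₁ h r)
    holds-sound (c-or c₁ c₂)    (inj₂ h)  r = e-orʳ (holds-sound c₂ h r)
    holds-sound (c-call {dir = dir} σ∈) h r
      with m′ , moved , ev ← r dir (index σ∈) h
      = e-call moved (≡.subst (EvalP M t m′) (state-index σ∈) ev)
    holds-sound (c-all h)       hs        r = e-all λ x x∈ → holds-sound (h x x∈) (hs x x∈) r
    holds-sound (c-any h) (x , x∈ , hx)   r = e-any x∈ (holds-sound (h x x∈) hx r)
    holds-sound (c-ifᵗ fM c)    h         r = e-ifᵗ fM (holds-sound c h r)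
    holds-sound (c-ifᶠ fM c)    h         r = e-ifᶠ fM (holds-sound c h r)

    UpRealizes : Pointer → StateSet → Set
    UpRealizes m U = ∀ q → T (lookup U q) → CallHolds m up (state q)

    SummarySound : Tree ar → Set
    SummarySound s = ∀ m U → nodeAt t m ≡ just s → UpRealizes m U →
                     ∀ q → T (lookup (apply (eval s) U) q) → EvalP M t m (state q)

    summary-sound       : ∀ s → SummarySound s
    child-summary-sound : ∀ {l} (cs : Vec (Tree ar) l) j {c} → cs ‼ j ≡ just c → SummarySound c

    summary-sound (node a cs) m U at upU q h =
      lfp-induction (step a (evals cs) U) HoldAt holdAt-step (λ _ ()) q
                    (≡.subst T (lookup-eval a cs U q) h)
      where
        HoldAt : Subset → Set
        HoldAt X = ∀ q → T (X q) → EvalP M t m (state q)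

        realizes : ∀ X → HoldAt X → Realizes m (localOracle U X (evals cs))
        realizes X holdAt up        q h = upU q h
        realizes X holdAt stay      q h = m , move-stay m , holdAt q h
        realizes X holdAt (child j) q h rewrite evals-‼ algebra cs j with cs ‼ j in c≡
        ... | just c = j ∷ m , move-child m j ,
                       child-summary-sound cs j c≡ (j ∷ m) (tabulate X) at′ upX q h
          where
            at′ : nodeAt t (j ∷ m) ≡ just c
            at′ = ≡.trans (nodeAt-child t j m) (≡.trans (cong (_>>= λ s → childAt s j) at) c≡)
            upX : UpRealizes (j ∷ m) (tabulate X)
            upX q′ h′ = m , refl , holdAt q′ (≡.subst T (lookup∘tabulate X q′) h′)

        holdAt-step : ∀ X → HoldAt X → HoldAt (X ∪ step a (evals cs) U X)
        holdAt-step X holdAt q h with Equivalence.to T-∨ h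
        ... | inj₁ hX    = holdAt q hX
        ... | inj₂ hstep = evalP at (holds-sound (clauseAt a q) (toWitness hstep) (realizes X holdAt))

    child-summary-sound (c ∷ cs) zero    refl = summary-sound c
    child-summary-sound (c ∷ cs) (suc j) c≡   = child-summary-sound cs j c≡

    -- The subtree at a pointer and the states holding at its parent, computed from the root
    -- downwards; nothing holds above the root.
    context : Pointer → Maybe (Tree ar × StateSet)
    context []      = just (t , none)
    context (j ∷ m) = context m >>= λ (s , U) → Maybe.map (_, apply (eval s) U) (childAt s j)

    holding : Pointer → StateSet
    holding m = maybe′ (λ (s , U) → apply (eval s) U) none (context m)

    context-nodeAt : ∀ m {s} → nodeAt t m ≡ just s → ∃ λ U → context m ≡ just (s , U)
    context-nodeAt []      refl = none , refl
    context-nodeAt (j ∷ m) at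
      with nodeAt t m | context-nodeAt m | ≡.trans (≡.sym (nodeAt-child t j m)) at
    ... | just s′ | ih | child≡ with U , ctx ← ih refl rewrite ctx | child≡ = _ , refl

    holding-up : ∀ m {m′ s U} → move m up ≡ just m′ → context m ≡ just (s , U) → holding m′ ≡ U
    holding-up (i ∷ m) refl ctx with context m
    ... | just (s′ , U′) with childAt s′ i
    ...   | just _ with refl ← ctx = refl

    holding-node : ∀ m {a cs U} → context m ≡ just (node a cs , U) →
                   holding m ≡ tabulate (lfp (step a (evals cs) U))
    holding-node m {U = U} ctx rewrite ctx = apply-table _ U

    holding-child : ∀ m j {s U} → context m ≡ just (s , U) →
                    holding (j ∷ m) ≡ maybe′ (λ c → apply (eval c) (holding m)) none (childAt s j)
    holding-child m j {s} ctx rewrite ctx with childAt s j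
    ... | just _  = refl
    ... | nothing = refl

    Covers : Pointer → Oracle → Set
    Covers m V = ∀ dir {m′} q → move m dir ≡ just m′ → T (lookup (holding m′) q) → T (V dir q)

    holds-complete   : ∀ {e m V} → EvalE M t m e → (c : CallsIn M e) → Covers m V → Holds c V
    holding-complete : ∀ {m σ} → EvalP M t m σ → ∀ q → state q ≡ σ → T (lookup (holding m) q)

    holds-complete e-true          c-true        cov = tt
    holds-complete (e-bool fM)     c-bool        cov = fM
    holds-complete (e-and ev₁ ev₂) (c-and c₁ c₂) cov =
      holds-complete ev₁ c₁ cov , holds-complete ev₂ c₂ cov
    holds-complete (e-orˡ ev)      (c-or c₁ c₂)  cov = inj₁ (holds-complete ev c₁ cov)
    holds-complete (e-orʳ ev)      (c-or c₁ c₂)  cov = inj₂ (holds-complete ev c₂ cov)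
    holds-complete (e-all ev)      (c-all c)     cov = λ x x∈ → holds-complete (ev x x∈) (c x x∈) cov
    holds-complete (e-any x∈ ev)   (c-any c)     cov = _ , x∈ , holds-complete ev (c _ x∈) cov
    holds-complete (e-ifᵗ _ ev)    (c-ifᵗ _ c)   cov = holds-complete ev c cov
    holds-complete (e-ifᶠ _ ev)    (c-ifᶠ _ c)   cov = holds-complete ev c cov
    holds-complete (e-ifᵗ fM _)    (c-ifᶠ fM′ _) cov with () ← ≡.trans (≡.sym fM) fM′
    holds-complete (e-ifᶠ fM _)    (c-ifᵗ fM′ _) cov with () ← ≡.trans (≡.sym fM′) fM
    holds-complete (e-call moved evP) (c-call σ∈) cov =
      cov _ (index σ∈) moved (holding-complete evP (index σ∈) (state-index σ∈))

    holding-complete {m} (evalP {a = a} {cs} at ev) q refl with U , ctx ← context-nodeAt m at =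
      ≡.subst T (≡.sym lookup-holding) (lfp-closed (step a (evals cs) U) q (fromWitness holds))
      where
        X = lfp (step a (evals cs) U)

        lookup-holding : ∀ {q} → lookup (holding m) q ≡ X q
        lookup-holding {q} = ≡.trans (cong (λ S → lookup S q) (holding-node m ctx)) (lookup∘tabulate X q)

        covers : Covers m (localOracle U X (evals cs))
        covers up q moved h = ≡.subst (λ S → T (lookup S q)) (holding-up m moved ctx) h
        covers stay q moved h with refl ← Maybe.just-injective (≡.trans (≡.sym moved) (move-stay m)) =
          ≡.subst T lookup-holding h
        covers (child j) q moved h with refl ← Maybe.just-injective (≡.trans (≡.sym moved) (move-child m j))
          rewrite evals-‼ algebra cs j | holding-child m j ctx | holding-node m ctx with cs ‼ j
        ... | just _  = h
        ... | nothing = ⊥-elim (none-empty q h)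

        holds : Holds (clauseAt a q) (localOracle U X (evals cs))
        holds = holds-complete ev (clauseAt a q) covers

  Recognizable-EvalP : ∀ {σ} → σ ∈ Asp M → Recognizable (λ e → EvalP M e [] σ)
  Recognizable-EvalP σ∈ = record
    { algebra    = algebra
    ; Accepting  = λ h → T (lookup (apply h none) (index σ∈))
    ; accepting? = λ h → T? (lookup (apply h none) (index σ∈))
    ; recognizes = λ e → mk⇔
        (λ acc → ≡.subst (EvalP M e []) (state-index σ∈)
                   (summary-sound e e [] none refl (λ q → ⊥-elim ∘ none-empty q) (index σ∈) acc))
        (λ ev → holding-complete e ev (index σ∈) (state-index σ∈))
    }

theorem4p3 : (L : SymbolicLanguage) (P : Facet L) →
    Semantics.WellFormed L P →
    Semantics.Characterizes L P →
    HasDecidableLearning L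
theorem4p3 L P wf ch exs G = ∃-InLang? (Recognizable-All example exs) G
  where
    open SymbolicLanguage L

    example : (ex : Struct × D) → Recognizable (λ e → sem (proj₁ ex) e ≡ proj₂ ex)
    example (M , d) =
      let σ , σ∈ , spec = ch M d
      in Recognizable-resp (λ e → mk⇔ (proj₁ (spec e)) (proj₂ (spec e)))
                           (FacetAutomaton.Recognizable-EvalP L P wf M σ∈)
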